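{- Let $n\in\mathbb{N}$ and let $\pi_1\colon C_2\oplus C_2\oplus C_n\to C_2\oplus C_2$ be the projection onto the first two summands. Let $A=g_1\cdots g_{2n+2}$ be a sequence of $2n+2$ pairwise distinct elements of $C_2\oplus C_2\oplus C_n$. If $\sum_{i=1}^{2n+2}\pi_1(g_i)\neq 0$, then there is a set $I\subseteq[1,2n+2]$ with $|I|=2n$ and $\sum_{i\in I}g_i=0$.
   Context: $C_m$ denotes a cyclic group of order $m$; groups are written additively. -}

module Defs where

open import Data.Nat using (ℕ; zero; suc; _+_; NonZero)
open import Data.Nat.DivMod using (_%_; m%n<n)
open import Data.Fin using (Fin; toℕ; fromℕ<)
open import Data.Fin.Subset using (Subset; Side; inside; outside)
open import Data.Vec using (lookup)
open import Data.Product using (_×_; _,_)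

C : ℕ → Set
C n = Fin n

0C : ∀ n → .{{_ : NonZero n}} → C n
0C (suc n) = Data.Fin.zero

_+C_ : ∀ {n} .{{_ : NonZero n}} → C n → C n → C n
_+C_ {n} a b = fromℕ< (m%n<n (toℕ a + toℕ b) n)

K : Set
K = C 2 × C 2

0K : K
0K = 0C 2 , 0C 2

_+K_ : K → K → K
(a , b) +K (c , d) = (a +C c) , (b +C d)

G : ℕ → Set
G n = C 2 × C 2 × C n

0G : ∀ n → .{{_ : NonZero n}} → G n
0G n = 0C 2 , 0C 2 , 0C n

_+G_ : ∀ {n} .{{_ : NonZero n}} → G n → G n → G n
(a , b , c) +G (a' , b' , c') = (a +C a') , (b +C b') , (c +C c')

π₁ : ∀ {n} → G n → K
π₁ (a , b , _) = a , b

sumFin : ∀ {A : Set} → A → (A → A → A) → ∀ m → (Fin m → A) → A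
sumFin z _⊕_ zero f = z
sumFin z _⊕_ (suc m) f = f Data.Fin.zero ⊕ sumFin z _⊕_ m (λ i → f (Data.Fin.suc i))

sumOver : ∀ {n} .{{_ : NonZero n}} {m} → Subset m → (Fin m → G n) → G n
sumOver {n} {m} I g = sumFin (0G n) _+G_ m (λ i → pick (lookup I i) (g i))
  where
  pick : Side → G n → G n
  pick inside x = x
  pick outside _ = 0G n

-- Let σ be the sum of all g i.  The 2(2n + 2) elements g a and σ − g b lie in a group
-- of order 4n, and both families are injective, so by pigeonhole g a + g b = σ for some
-- a, b.  If a = b then σ = 2 g a has trivial C₂ ⊕ C₂ component, which the hypothesis
-- forbids; so a ≠ b, and the other 2n elements sum to σ − g a − g b = 0.

module Submission where

open import Defs
open import Algebra.Bundles using (AbelianGroup)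
open import Algebra.Structures using (IsAbelianGroup)
import Algebra.Properties.AbelianGroup as AbelianGroupProperties
open import Data.Fin using (Fin; zero; suc; toℕ; fromℕ<; combine; splitAt; join)
open import Data.Fin.Properties
  using (toℕ-fromℕ<; toℕ-injective; toℕ<n; combine-injective; join-splitAt; pigeonhole; <⇒≢)
open import Data.Fin.Subset using (Subset; ∣_∣; _∈_; _-_; ⊤; inside; outside)
open import Data.Fin.Subset.Properties using (∈⊤; ∣⊤∣≡n; p─⊥≡p; x∈p∧x≢y⇒x∈p-y)
open import Data.Nat using (ℕ; zero; suc; _+_; _*_; _∸_; _<_; z≤n; s≤s; NonZero)
open import Data.Nat.DivMod using (_%_; m%n<n; %-distribˡ-+; m%n%n≡m%n; n%n≡0; m<n⇒m%n≡m)
open import Data.Nat.Properties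
  using (+-comm; +-assoc; m∸n+n≡m; <⇒≤; +-mono-<; +-monoʳ-<; m<m+n; +-cancelˡ-≡)
open import Data.Product using (Σ; ∃₂; _×_; _,_)
open import Data.Sum using (inj₁; inj₂; [_,_]′)
open import Data.Vec using (_∷_; here; there)
open import Function using (_∘_)
open import Function.Definitions using (Injective)
open import Level using (0ℓ)
open import Relation.Binary.PropositionalEquality
open import Relation.Nullary using (¬_; contradiction)

toℕ-0C : ∀ m .{{_ : NonZero m}} → toℕ (0C m) ≡ 0
toℕ-0C (suc _) = refl

module _ {m : ℕ} .{{_ : NonZero m}} where

  toℕ-+C : (a b : C m) → toℕ (a +C b) ≡ (toℕ a + toℕ b) % m
  toℕ-+C a b = toℕ-fromℕ< _

  [m%d+n]%d≡[m+n]%d : ∀ x y → (x % m + y) % m ≡ (x + y) % m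
  [m%d+n]%d≡[m+n]%d x y = begin
    (x % m + y) % m         ≡⟨ %-distribˡ-+ (x % m) y m ⟩
    (x % m % m + y % m) % m ≡⟨ cong (λ v → (v + y % m) % m) (m%n%n≡m%n x m) ⟩
    (x % m + y % m) % m     ≡⟨ %-distribˡ-+ x y m ⟨
    (x + y) % m             ∎
    where open ≡-Reasoning

  [m+n%d]%d≡[m+n]%d : ∀ x y → (x + y % m) % m ≡ (x + y) % m
  [m+n%d]%d≡[m+n]%d x y = begin
    (x + y % m) % m ≡⟨ cong (_% m) (+-comm x (y % m)) ⟩
    (y % m + x) % m ≡⟨ [m%d+n]%d≡[m+n]%d y x ⟩
    (y + x) % m     ≡⟨ cong (_% m) (+-comm y x) ⟩
    (x + y) % m     ∎
    where open ≡-Reasoning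

  +C-comm : (a b : C m) → a +C b ≡ b +C a
  +C-comm a b = toℕ-injective (begin
    toℕ (a +C b)          ≡⟨ toℕ-+C a b ⟩
    (toℕ a + toℕ b) % m   ≡⟨ cong (_% m) (+-comm (toℕ a) (toℕ b)) ⟩
    (toℕ b + toℕ a) % m   ≡⟨ toℕ-+C b a ⟨
    toℕ (b +C a)          ∎)
    where open ≡-Reasoning

  +C-assoc : (a b c : C m) → (a +C b) +C c ≡ a +C (b +C c)
  +C-assoc a b c = toℕ-injective (begin
    toℕ ((a +C b) +C c)                 ≡⟨ toℕ-+C (a +C b) c ⟩
    (toℕ (a +C b) + toℕ c) % m          ≡⟨ cong (λ v → (v + toℕ c) % m) (toℕ-+C a b) ⟩
    ((toℕ a + toℕ b) % m + toℕ c) % m   ≡⟨ [m%d+n]%d≡[m+n]%d (toℕ a + toℕ b) (toℕ c) ⟩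
    (toℕ a + toℕ b + toℕ c) % m         ≡⟨ cong (_% m) (+-assoc (toℕ a) (toℕ b) (toℕ c)) ⟩
    (toℕ a + (toℕ b + toℕ c)) % m       ≡⟨ [m+n%d]%d≡[m+n]%d (toℕ a) (toℕ b + toℕ c) ⟨
    (toℕ a + (toℕ b + toℕ c) % m) % m   ≡⟨ cong (λ v → (toℕ a + v) % m) (toℕ-+C b c) ⟨
    (toℕ a + toℕ (b +C c)) % m          ≡⟨ toℕ-+C a (b +C c) ⟨
    toℕ (a +C (b +C c))                 ∎)
    where open ≡-Reasoning

  +C-identityˡ : (a : C m) → 0C m +C a ≡ a
  +C-identityˡ a = toℕ-injective (begin
    toℕ (0C m +C a)            ≡⟨ toℕ-+C (0C m) a ⟩
    (toℕ (0C m) + toℕ a) % m   ≡⟨ cong (λ v → (v + toℕ a) % m) (toℕ-0C m) ⟩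
    toℕ a % m                  ≡⟨ m<n⇒m%n≡m (toℕ<n a) ⟩
    toℕ a                      ∎)
    where open ≡-Reasoning

  -C_ : C m → C m
  -C a = fromℕ< (m%n<n (m ∸ toℕ a) m)

  +C-inverseˡ : (a : C m) → (-C a) +C a ≡ 0C m
  +C-inverseˡ a = toℕ-injective (begin
    toℕ ((-C a) +C a)                 ≡⟨ toℕ-+C (-C a) a ⟩
    (toℕ (-C a) + toℕ a) % m          ≡⟨ cong (λ v → (v + toℕ a) % m) (toℕ-fromℕ< _) ⟩
    ((m ∸ toℕ a) % m + toℕ a) % m     ≡⟨ [m%d+n]%d≡[m+n]%d (m ∸ toℕ a) (toℕ a) ⟩
    (m ∸ toℕ a + toℕ a) % m           ≡⟨ cong (_% m) (m∸n+n≡m (<⇒≤ (toℕ<n a))) ⟩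
    m % m                             ≡⟨ n%n≡0 m ⟩
    0                                 ≡⟨ toℕ-0C m ⟨
    toℕ (0C m)                        ∎)
    where open ≡-Reasoning

x+x≡0-C₂ : (a : C 2) → a +C a ≡ 0C 2
x+x≡0-C₂ zero       = refl
x+x≡0-C₂ (suc zero) = refl

module _ {n : ℕ} .{{_ : NonZero n}} where

  -G_ : G n → G n
  -G (a , b , c) = -C a , -C b , -C c

  +G-isAbelianGroup : IsAbelianGroup _≡_ _+G_ (0G n) -G_
  +G-isAbelianGroup = record
    { isGroup = record
      { isMonoid = record
        { isSemigroup = record
          { isMagma = record { isEquivalence = isEquivalence ; ∙-cong = cong₂ _+G_ }
          ; assoc   = assoc
          }
        ; identity = identityˡ , λ x → trans (comm x (0G n)) (identityˡ x)
        }
      ; inverse = inverseˡ , λ x → trans (comm x (-G x)) (inverseˡ x)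
      ; ⁻¹-cong = cong -G_
      }
    ; comm = comm
    }
    where
    comm : ∀ x y → x +G y ≡ y +G x
    comm (a , b , c) (a′ , b′ , c′) =
      cong₂ _,_ (+C-comm a a′) (cong₂ _,_ (+C-comm b b′) (+C-comm c c′))

    assoc : ∀ x y z → (x +G y) +G z ≡ x +G (y +G z)
    assoc (a , b , c) (a′ , b′ , c′) (a″ , b″ , c″) =
      cong₂ _,_ (+C-assoc a a′ a″) (cong₂ _,_ (+C-assoc b b′ b″) (+C-assoc c c′ c″))

    identityˡ : ∀ x → 0G n +G x ≡ x
    identityˡ (a , b , c) = cong₂ _,_ (+C-identityˡ a) (cong₂ _,_ (+C-identityˡ b) (+C-identityˡ c))

    inverseˡ : ∀ x → (-G x) +G x ≡ 0G n
    inverseˡ (a , b , c) = cong₂ _,_ (+C-inverseˡ a) (cong₂ _,_ (+C-inverseˡ b) (+C-inverseˡ c))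

  G-abelianGroup : AbelianGroup 0ℓ 0ℓ
  G-abelianGroup = record { isAbelianGroup = +G-isAbelianGroup }

  G-encode : G n → Fin (2 * (2 * n))
  G-encode (a , b , c) = combine a (combine b c)

  G-encode-injective : Injective _≡_ _≡_ G-encode
  G-encode-injective {a , b , c} {a′ , b′ , c′} e with combine-injective a _ a′ _ e
  ... | refl , e′ with combine-injective b c b′ c′ e′
  ... | refl , refl = refl

  π₁[x+x]≡0K : (x : G n) → π₁ (x +G x) ≡ 0K
  π₁[x+x]≡0K (a , b , _) = cong₂ _,_ (x+x≡0-C₂ a) (x+x≡0-C₂ b)

sumFin-homo : ∀ {A B : Set} {ε : A} {ε′ : B} {_⊕_ : A → A → A} {_⊞_ : B → B → B} (φ : A → B)
  → φ ε ≡ ε′ → (∀ x y → φ (x ⊕ y) ≡ φ x ⊞ φ y)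
  → ∀ m (f : Fin m → A) → φ (sumFin ε _⊕_ m f) ≡ sumFin ε′ _⊞_ m (φ ∘ f)
sumFin-homo φ φε homo zero    f = φε
sumFin-homo {_⊞_ = _⊞_} φ φε homo (suc m) f =
  trans (homo _ _) (cong (φ (f zero) ⊞_) (sumFin-homo φ φε homo m (f ∘ suc)))

x∈p⇒suc∣p-x∣≡∣p∣ : ∀ {m} {p : Subset m} {x} → x ∈ p → suc ∣ p - x ∣ ≡ ∣ p ∣
x∈p⇒suc∣p-x∣≡∣p∣ {p = inside ∷ p} here = cong (suc ∘ ∣_∣) (p─⊥≡p p)
x∈p⇒suc∣p-x∣≡∣p∣ {p = inside  ∷ p} (there x∈p) = cong suc (x∈p⇒suc∣p-x∣≡∣p∣ x∈p)
x∈p⇒suc∣p-x∣≡∣p∣ {p = outside ∷ p} (there x∈p) = x∈p⇒suc∣p-x∣≡∣p∣ x∈p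

2+∣⊤-x-y∣≡m : ∀ {m} {x y : Fin m} → x ≢ y → 2 + ∣ ⊤ - x - y ∣ ≡ m
2+∣⊤-x-y∣≡m {m} {x} {y} x≢y = begin
  suc (suc ∣ ⊤ - x - y ∣) ≡⟨ cong suc (x∈p⇒suc∣p-x∣≡∣p∣ {p = ⊤ - x} {y} y∈⊤-x) ⟩
  suc ∣ ⊤ - x ∣           ≡⟨ x∈p⇒suc∣p-x∣≡∣p∣ {p = ⊤} {x} ∈⊤ ⟩
  ∣ ⊤ {m} ∣               ≡⟨ ∣⊤∣≡n m ⟩
  m                       ∎
  where
  open ≡-Reasoning
  y∈⊤-x : y ∈ ⊤ - x
  y∈⊤-x = x∈p∧x≢y⇒x∈p-y ∈⊤ (x≢y ∘ sym)

images-intersect : ∀ {A : Set} {m k} (enc : A → Fin k) → Injective _≡_ _≡_ enc → k < m + m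
  → (f h : Fin m → A) → Injective _≡_ _≡_ f → Injective _≡_ _≡_ h → ∃₂ λ a b → f a ≡ h b
images-intersect {m = m} enc enc-injective k<m+m f h f-injective h-injective
  with i , j , i<j , e ← pigeonhole k<m+m (enc ∘ [ f , h ]′ ∘ splitAt m)
  = meet (splitAt m i) (splitAt m j) (<⇒≢ i<j ∘ splitAt-injective) (enc-injective e)
  where
  splitAt-injective : splitAt m i ≡ splitAt m j → i ≡ j
  splitAt-injective s = trans (sym (join-splitAt m m i)) (trans (cong (join m m) s) (join-splitAt m m j))

  meet : ∀ u v → u ≢ v → [ f , h ]′ u ≡ [ f , h ]′ v → ∃₂ λ a b → f a ≡ h b
  meet (inj₁ a) (inj₁ a′) u≢v e = contradiction (cong inj₁ (f-injective e)) u≢v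
  meet (inj₁ a) (inj₂ b)  _   e = a , b , e
  meet (inj₂ b) (inj₁ a)  _   e = a , b , sym e
  meet (inj₂ b) (inj₂ b′) u≢v e = contradiction (cong inj₂ (h-injective e)) u≢v

module _ {n : ℕ} .{{_ : NonZero n}} where
  open AbelianGroup (G-abelianGroup {n}) using (assoc; identityˡ; commutativeSemigroup)
  open AbelianGroupProperties (G-abelianGroup {n})
    using (∙-cancelˡ; ⁻¹-injective; //-rightDividesˡ; identityʳ-unique)
  open import Algebra.Properties.CommutativeSemigroup commutativeSemigroup using (x∙yz≈y∙xz)

  ∃-pair-with-sum : ∀ {m} (g : Fin m → G n) → Injective _≡_ _≡_ g → 2 * (2 * n) < m + m
    → ∀ t → ∃₂ λ a b → g a +G g b ≡ t
  ∃-pair-with-sum g g-injective size t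
    with a , b , e ← images-intersect G-encode G-encode-injective size
                       g (λ y → t +G (-G g y)) g-injective
                       (λ {y} {y′} eq → g-injective (⁻¹-injective (∙-cancelˡ t (-G g y) (-G g y′) eq)))
    = a , b , trans (cong (_+G g b) e) (//-rightDividesˡ (g b) t)

  sumOver-⊤ : ∀ {m} (g : Fin m → G n) → sumOver ⊤ g ≡ sumFin (0G n) _+G_ m g
  sumOver-⊤ {zero}  g = refl
  sumOver-⊤ {suc m} g = cong (g zero +G_) (sumOver-⊤ (g ∘ suc))

  x∈p⇒sumOver[p]≡g[x]+sumOver[p-x] : ∀ {m} {p : Subset m} {x} (g : Fin m → G n) → x ∈ p
    → sumOver p g ≡ g x +G sumOver (p - x) g
  x∈p⇒sumOver[p]≡g[x]+sumOver[p-x] {p = inside ∷ p} g here =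
    cong (g zero +G_) (sym (trans (identityˡ _) (cong (λ q → sumOver q (g ∘ suc)) (p─⊥≡p p))))
  x∈p⇒sumOver[p]≡g[x]+sumOver[p-x] {p = inside ∷ p} {suc x} g (there x∈p) =
    trans (cong (g zero +G_) (x∈p⇒sumOver[p]≡g[x]+sumOver[p-x] (g ∘ suc) x∈p))
          (x∙yz≈y∙xz (g zero) (g (suc x)) (sumOver (p - x) (g ∘ suc)))
  x∈p⇒sumOver[p]≡g[x]+sumOver[p-x] {p = outside ∷ p} {suc x} g (there x∈p) =
    trans (cong (0G n +G_) (x∈p⇒sumOver[p]≡g[x]+sumOver[p-x] (g ∘ suc) x∈p))
          (x∙yz≈y∙xz (0G n) (g (suc x)) (sumOver (p - x) (g ∘ suc)))

  sum≡g[x]+g[y]+sumOver[⊤-x-y] : ∀ {m} (g : Fin m → G n) {x y} → x ≢ y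
    → sumFin (0G n) _+G_ m g ≡ (g x +G g y) +G sumOver (⊤ - x - y) g
  sum≡g[x]+g[y]+sumOver[⊤-x-y] {m} g {x} {y} x≢y = begin
    sumFin (0G n) _+G_ m g                ≡⟨ sumOver-⊤ g ⟨
    sumOver ⊤ g                           ≡⟨ x∈p⇒sumOver[p]≡g[x]+sumOver[p-x] {p = ⊤} {x} g ∈⊤ ⟩
    g x +G sumOver (⊤ - x) g              ≡⟨ cong (g x +G_) (x∈p⇒sumOver[p]≡g[x]+sumOver[p-x] g y∈⊤-x) ⟩
    g x +G (g y +G sumOver (⊤ - x - y) g) ≡⟨ assoc (g x) (g y) (sumOver (⊤ - x - y) g) ⟨
    (g x +G g y) +G sumOver (⊤ - x - y) g ∎
    where
    open ≡-Reasoning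
    y∈⊤-x : y ∈ ⊤ - x
    y∈⊤-x = x∈p∧x≢y⇒x∈p-y ∈⊤ (x≢y ∘ sym)

  sumOver[⊤-x-y]≡0 : ∀ {m} (g : Fin m → G n) {x y} → x ≢ y
    → g x +G g y ≡ sumFin (0G n) _+G_ m g → sumOver (⊤ - x - y) g ≡ 0G n
  sumOver[⊤-x-y]≡0 {m} g {x} {y} x≢y gx+gy≡σ =
    identityʳ-unique σ (sumOver (⊤ - x - y) g) (sym (begin
      σ                                     ≡⟨ sum≡g[x]+g[y]+sumOver[⊤-x-y] g x≢y ⟩
      (g x +G g y) +G sumOver (⊤ - x - y) g ≡⟨ cong (_+G sumOver (⊤ - x - y) g) gx+gy≡σ ⟩
      σ +G sumOver (⊤ - x - y) g            ∎))
    where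
    open ≡-Reasoning
    σ : G n
    σ = sumFin (0G n) _+G_ m g

  sum-π₁≢0K⇒x≢y : ∀ {m} (g : Fin m → G n) {x y} → ¬ (sumFin 0K _+K_ m (π₁ ∘ g) ≡ 0K)
    → g x +G g y ≡ sumFin (0G n) _+G_ m g → x ≢ y
  sum-π₁≢0K⇒x≢y {m} g {x} Σπ₁≢0K gx+gx≡σ refl = Σπ₁≢0K (begin
    sumFin 0K _+K_ m (π₁ ∘ g)   ≡⟨ π₁-sum ⟨
    π₁ (sumFin (0G n) _+G_ m g) ≡⟨ cong π₁ gx+gx≡σ ⟨
    π₁ (g x +G g x)             ≡⟨ π₁[x+x]≡0K (g x) ⟩
    0K                          ∎)
    where
    open ≡-Reasoning
    π₁-sum : π₁ (sumFin (0G n) _+G_ m g) ≡ sumFin 0K _+K_ m (π₁ ∘ g)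
    π₁-sum = sumFin-homo {ε = 0G n} {ε′ = 0K} {_⊕_ = _+G_} {_⊞_ = _+K_} π₁ refl (λ _ _ → refl) m g

4n<[2n+2]+[2n+2] : ∀ n → 2 * (2 * n) < (2 * n + 2) + (2 * n + 2)
4n<[2n+2]+[2n+2] n = +-mono-< (m<m+n (2 * n) 0<2) (+-monoʳ-< (2 * n) 0<2)
  where
  0<2 : 0 < 2
  0<2 = s≤s z≤n

proposition5p4 : (n : ℕ) → .{{_ : NonZero n}} → (g : Fin (2 * n + 2) → G n)
    → Injective _≡_ _≡_ g
    → ¬ (sumFin 0K _+K_ (2 * n + 2) (λ i → π₁ (g i)) ≡ 0K)
    → Σ (Subset (2 * n + 2)) (λ I → (∣ I ∣ ≡ 2 * n) × (sumOver I g ≡ 0G n))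
proposition5p4 n g g-injective Σπ₁≢0K =
  let σ = sumFin (0G n) _+G_ (2 * n + 2) g
      a , b , ga+gb≡σ = ∃-pair-with-sum g g-injective (4n<[2n+2]+[2n+2] n) σ
      a≢b = sum-π₁≢0K⇒x≢y g Σπ₁≢0K ga+gb≡σ
  in ⊤ - a - b
   , +-cancelˡ-≡ 2 ∣ ⊤ - a - b ∣ (2 * n) (trans (2+∣⊤-x-y∣≡m a≢b) (+-comm (2 * n) 2))
   , sumOver[⊤-x-y]≡0 g a≢b ga+gb≡σ
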